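{- Let $G$ be a simple graph with $n \geq 4$ vertices and $m$ edges, with degree sequence $\Delta = d_1 \geq d_2 \geq \cdots \geq d_{n-1} \geq d_n = \delta$. Then \[ M_1(G) \geq \Delta^2 + \frac{(2m - \Delta)^2}{n-1} + \frac{1}{2}(d_2 - \delta)^2 + \frac{2(n-1)}{n-3}\left(\frac{2m - \Delta}{n-1} - \frac{d_2 + \delta}{2}\right)^2 \] and \[ M_1(G) \geq \delta^2 + \frac{(2m - \delta)^2}{n-1} + \frac{1}{2}(\Delta - d_{n-1})^2 + \frac{2(n-1)}{n-3}\left(\frac{2m - \delta}{n-1} - \frac{\Delta + d_{n-1}}{2}\right)^2. \] Equality holds in the first inequality if and only if $G$ is regular, or $G \in \Gamma_{3,n-1}$, or $G \in \Gamma_{3,n}$, or $G \in \Gamma_{2,n-1}$, or $G \in \Gamma_{2,n}$, or $G \in \Gamma_{1,n-1}$. Equality holds in the second inequality if and only if $G$ is regular, or $G \in \Gamma_{2,n-2}$, or $G \in \Gamma_{2,n-1}$, or $G \in \Gamma_{2,n}$, or $G \in \Gamma_{1,n-2}$, or $G \in \Gamma_{1,n-1}$.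
   Context: $M_1(G) = \sum_{i=1}^n d_i^2$. For $1 \le i < j \le n$, $\Gamma_{i,j}$ denotes the class of graphs (with vertices ordered so that $d_1 \ge \cdots \ge d_n$) such that $d_i = d_{i+1} = \cdots = d_j$. -}

module Defs where

open import Data.Bool using (Bool; true; false; if_then_else_; _∧_)
open import Data.Nat as ℕ using (ℕ; zero; suc; _∸_; _<ᵇ_; _^_; _≤_)
open import Data.Fin as Fin using (Fin; toℕ)
open import Data.List using (List; map; allFin)
open import Data.Nat.ListAction using (sum)
open import Data.Integer using (ℤ; +_; 1ℤ)
open import Data.Rational using (ℚ; _/_; _+_; _*_; _-_; 0ℚ)
open import Relation.Binary.PropositionalEquality using (_≡_)
import Relation.Nullary

record SimpleGraph (n : ℕ) : Set where
  field
    adj    : Fin n → Fin n → Bool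
    sym    : ∀ u v → adj u v ≡ adj v u
    irrefl : ∀ u → adj u u ≡ false
open SimpleGraph public

deg : ∀ {n} → SimpleGraph n → Fin n → ℕ
deg {n} G u = sum (map (λ v → if adj G u v then 1 else 0) (allFin n))

edges : ∀ {n} → SimpleGraph n → ℕ
edges {n} G =
  sum (map (λ u → sum (map (λ v → if (adj G u v ∧ (toℕ u <ᵇ toℕ v)) then 1 else 0)
                           (allFin n)))
           (allFin n))

M1 : ∀ {n} → SimpleGraph n → ℕ
M1 {n} G = sum (map (λ u → deg G u ^ 2) (allFin n))

DegreesNonIncreasing : ∀ {n} → SimpleGraph n → Set
DegreesNonIncreasing G = ∀ u v → u Fin.≤ v → deg G v ≤ deg G u

-- 1-based degree sequence d_i (i = 1..n); 0 outside that range (never used)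
dseq : ∀ {n} → SimpleGraph n → ℕ → ℕ
dseq {n} G zero = 0
dseq {n} G (suc i) with i ℕ.<? n
... | Relation.Nullary.yes p = deg G (Fin.fromℕ< p)
... | Relation.Nullary.no _ = 0

Γ : ∀ {n} → ℕ → ℕ → SimpleGraph n → Set
Γ i j G = ∀ k → i ≤ k → k ≤ j → dseq G k ≡ dseq G i

Regular : ∀ {n} → SimpleGraph n → Set
Regular G = ∀ u v → deg G u ≡ deg G v

ℕ→ℚ : ℕ → ℚ
ℕ→ℚ k = + k / 1

-- q / d for a natural d (totalised: value 0 when d = 0, never used here)
_/ℕ_ : ℚ → ℕ → ℚ
q /ℕ zero = 0ℚ
q /ℕ suc d = q * (1ℤ / suc d)

sq : ℚ → ℚ
sq x = x * x

bound : (n m a b c : ℕ) → ℚ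
bound n m a b c =
  sq A + (sq (ℕ→ℚ (2 ℕ.* m) - A) /ℕ (n ∸ 1))
       + (sq (B - C) /ℕ 2)
       + ((ℕ→ℚ (2 ℕ.* (n ∸ 1)) /ℕ (n ∸ 3))
          * sq (((ℕ→ℚ (2 ℕ.* m) - A) /ℕ (n ∸ 1)) - ((B + C) /ℕ 2)))
  where
  A = ℕ→ℚ a
  B = ℕ→ℚ b
  C = ℕ→ℚ c

module Submission where

-- Split M₁ = d_a² + d_b² + d_c² + Σ_{i ∈ I} d_i², where (a, b, c) = (1, 2, n) for
-- the first bound and (n, 1, n − 1) for the second, and I holds the remaining
-- n − 3 indices; by the handshake lemma R = Σ_{i ∈ I} d_i = 2m − d_a − d_b − d_c.
-- The right-hand side of each bound is identically d_a² + d_b² + d_c² + R²/(n − 3),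
-- so each inequality is Cauchy–Schwarz R² ≤ (n − 3) Σ_{i ∈ I} d_i², with equality
-- iff the degrees indexed by I coincide; every class listed in the equality
-- statements is contained in that one.

open import Defs hiding (sym)
open import Data.Nat using (ℕ; zero; suc; _∸_; _≤_)
open import Data.Fin using (Fin; toℕ)
open import Data.Product using (_×_; _,_; proj₁; proj₂)
open import Data.Sum using (_⊎_; inj₁; inj₂; [_,_]′)
open import Data.Vec.Functional using (Vector)
open import Data.Rational using (ℚ) renaming (_≤_ to _≤ℚ_)
open import Function using (_∘_)
open import Function.Bundles using (_⇔_; mk⇔; Equivalence)
open import Relation.Binary.PropositionalEquality
  using (_≡_; refl; sym; trans; cong; cong₂; subst; subst₂; module ≡-Reasoning)

Constant : ∀ {a} {A : Set a} {n} → Vector A n → Set a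
Constant t = ∀ i j → t i ≡ t j

module CauchySchwarz where

  open import Data.Nat using (_+_; _*_; ∣_-_∣; z≤n)
  open import Data.Nat.Properties
  open import Data.Nat.Tactic.RingSolver using (solve-∀)
  open import Data.Fin using (zero; suc)
  open import Data.Vec.Functional using (tail)
  open import Algebra.Properties.Semiring.Sum +-*-semiring
    using (sum; sum-syntax; sum-cong-≗; ∑-distrib-+; *-distribˡ-sum)
  open ≡-Reasoning

  private
    square-expansion : ∀ m d → m * m + (m + d) * (m + d) ≡ 2 * (m * (m + d)) + d * d
    square-expansion = solve-∀

    ordered-sum-of-squares : ∀ {m n} → m ≤ n →
      m * m + n * n ≡ 2 * (m * n) + ∣ m - n ∣ * ∣ m - n ∣
    ordered-sum-of-squares {m} m≤n with m≤n⇒∃[o]m+o≡n m≤n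
    ... | d , refl = trans (square-expansion m d)
      (cong (λ x → 2 * (m * (m + d)) + x * x) (sym (∣m-m+n∣≡n m d)))

  m*m+n*n≡2*m*n+∣m-n∣² : ∀ m n → m * m + n * n ≡ 2 * (m * n) + ∣ m - n ∣ * ∣ m - n ∣
  m*m+n*n≡2*m*n+∣m-n∣² m n with ≤-total m n
  ... | inj₁ m≤n = ordered-sum-of-squares m≤n
  ... | inj₂ n≤m = begin
    m * m + n * n                        ≡⟨ +-comm (m * m) (n * n) ⟩
    n * n + m * m                        ≡⟨ ordered-sum-of-squares n≤m ⟩
    2 * (n * m) + ∣ n - m ∣ * ∣ n - m ∣  ≡⟨ cong₂ (λ p q → 2 * p + q * q) (*-comm n m) (∣-∣-comm n m) ⟩
    2 * (m * n) + ∣ m - n ∣ * ∣ m - n ∣  ∎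

  2*m*n≤m*m+n*n : ∀ m n → 2 * (m * n) ≤ m * m + n * n
  2*m*n≤m*m+n*n m n = subst (2 * (m * n) ≤_) (sym (m*m+n*n≡2*m*n+∣m-n∣² m n)) (m≤m+n _ _)

  2*m*n≡m*m+n*n⇒m≡n : ∀ m n → 2 * (m * n) ≡ m * m + n * n → m ≡ n
  2*m*n≡m*m+n*n⇒m≡n m n eq = [ ∣m-n∣≡0⇒m≡n , ∣m-n∣≡0⇒m≡n ]′ (m*n≡0⇒m≡0∨n≡0 ∣ m - n ∣ ∣m-n∣²≡0)
    where
    ∣m-n∣²≡0 : ∣ m - n ∣ * ∣ m - n ∣ ≡ 0
    ∣m-n∣²≡0 = sym (+-cancelˡ-≡ (2 * (m * n)) 0 _
      (trans (+-identityʳ _) (trans eq (m*m+n*n≡2*m*n+∣m-n∣² m n))))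

  +-mono-≤-equality : ∀ {m n o p} → m ≤ n → o ≤ p → m + o ≡ n + p → m ≡ n × o ≡ p
  +-mono-≤-equality {m} {n} {o} {p} m≤n o≤p eq = m≡n , +-cancelˡ-≡ n o p (trans (cong (_+ o) (sym m≡n)) eq)
    where
    m≡n : m ≡ n
    m≡n = ≤-antisym m≤n (+-cancelʳ-≤ o n m (≤-trans (+-monoʳ-≤ n o≤p) (≤-reflexive (sym eq))))

  ∑-mono-≤ : ∀ {K} {f g : Vector ℕ K} → (∀ i → f i ≤ g i) → sum f ≤ sum g
  ∑-mono-≤ {zero}  f≤g = z≤n
  ∑-mono-≤ {suc K} f≤g = +-mono-≤ (f≤g zero) (∑-mono-≤ (f≤g ∘ suc))

  ∑-mono-≤-equality : ∀ {K} {f g : Vector ℕ K} → (∀ i → f i ≤ g i) → sum f ≡ sum g → ∀ i → f i ≡ g i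
  ∑-mono-≤-equality {suc K} f≤g eq zero    =
    proj₁ (+-mono-≤-equality (f≤g zero) (∑-mono-≤ (f≤g ∘ suc)) eq)
  ∑-mono-≤-equality {suc K} f≤g eq (suc i) =
    ∑-mono-≤-equality (f≤g ∘ suc) (proj₂ (+-mono-≤-equality (f≤g zero) (∑-mono-≤ (f≤g ∘ suc)) eq)) i

  ∑-const : ∀ K c → ∑[ i < K ] c ≡ K * c
  ∑-const zero    c = refl
  ∑-const (suc K) c = cong (c +_) (∑-const K c)

  module _ {K} (x : ℕ) (t : Vector ℕ K) where

    private
      2*x*∑≡∑2*x* : 2 * (x * sum t) ≡ ∑[ i < K ] (2 * (x * t i))
      2*x*∑≡∑2*x* = trans (cong (2 *_) (*-distribˡ-sum x t)) (*-distribˡ-sum 2 (λ i → x * t i))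

      ∑x*x+t*t≡ : ∑[ i < K ] (x * x + t i * t i) ≡ K * (x * x) + ∑[ i < K ] (t i * t i)
      ∑x*x+t*t≡ = trans (∑-distrib-+ (λ _ → x * x) (λ i → t i * t i))
        (cong (_+ ∑[ i < K ] (t i * t i)) (∑-const K (x * x)))

    2*x*∑≤K*x*x+∑² : 2 * (x * sum t) ≤ K * (x * x) + ∑[ i < K ] (t i * t i)
    2*x*∑≤K*x*x+∑² = subst₂ _≤_ (sym 2*x*∑≡∑2*x*) ∑x*x+t*t≡ (∑-mono-≤ (λ i → 2*m*n≤m*m+n*n x (t i)))

    2*x*∑≡K*x*x+∑²⇒x≡t : 2 * (x * sum t) ≡ K * (x * x) + ∑[ i < K ] (t i * t i) → ∀ i → x ≡ t i
    2*x*∑≡K*x*x+∑²⇒x≡t eq i = 2*m*n≡m*m+n*n⇒m≡n x (t i)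
      (∑-mono-≤-equality (λ i → 2*m*n≤m*m+n*n x (t i)) (trans (sym 2*x*∑≡∑2*x*) (trans eq (sym ∑x*x+t*t≡))) i)

  private
    square-of-head+tail : ∀ x T → (x + T) * (x + T) ≡ x * x + (2 * (x * T) + T * T)
    square-of-head+tail = solve-∀

    scaled-head+tail : ∀ K x Q → suc K * (x * x + Q) ≡ x * x + ((K * (x * x) + Q) + K * Q)
    scaled-head+tail = solve-∀

    square-of-scaled : ∀ K x → (K * x) * (K * x) ≡ K * (K * (x * x))
    square-of-scaled = solve-∀

  cauchy-schwarz : ∀ {K} (t : Vector ℕ K) → sum t * sum t ≤ K * ∑[ i < K ] (t i * t i)
  cauchy-schwarz {zero}  t = z≤n
  cauchy-schwarz {suc K} t = subst₂ _≤_
    (sym (square-of-head+tail (t zero) (sum (tail t))))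
    (sym (scaled-head+tail K (t zero) (∑[ i < K ] (tail t i * tail t i))))
    (+-monoʳ-≤ (t zero * t zero)
      (+-mono-≤ (2*x*∑≤K*x*x+∑² (t zero) (tail t)) (cauchy-schwarz (tail t))))

  cauchy-schwarz-equality⇒Constant : ∀ {K} (t : Vector ℕ K) →
    sum t * sum t ≡ K * ∑[ i < K ] (t i * t i) → Constant t
  cauchy-schwarz-equality⇒Constant {zero}  t _  ()
  cauchy-schwarz-equality⇒Constant {suc K} t eq i j = trans (≡head i) (sym (≡head j))
    where
    x T Q : ℕ
    x = t zero
    T = sum (tail t)
    Q = ∑[ i < K ] (tail t i * tail t i)
    tail-equalities : 2 * (x * T) ≡ K * (x * x) + Q × T * T ≡ K * Q
    tail-equalities = +-mono-≤-equality (2*x*∑≤K*x*x+∑² x (tail t)) (cauchy-schwarz (tail t))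
      (+-cancelˡ-≡ (x * x) _ _ (trans (sym (square-of-head+tail x T)) (trans eq (scaled-head+tail K x Q))))
    ≡head : ∀ i → t i ≡ x
    ≡head zero    = refl
    ≡head (suc i) = sym (2*x*∑≡K*x*x+∑²⇒x≡t x (tail t) (proj₁ tail-equalities) i)

  Constant⇒cauchy-schwarz-equality : ∀ {K} (t : Vector ℕ K) →
    Constant t → sum t * sum t ≡ K * ∑[ i < K ] (t i * t i)
  Constant⇒cauchy-schwarz-equality {zero}  t _ = refl
  Constant⇒cauchy-schwarz-equality {suc K} t c = begin
    sum t * sum t                        ≡⟨ cong₂ _*_ ∑t≡ ∑t≡ ⟩
    (suc K * x) * (suc K * x)            ≡⟨ square-of-scaled (suc K) x ⟩
    suc K * (suc K * (x * x))            ≡⟨ cong (suc K *_) ∑t²≡ ⟨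
    suc K * ∑[ i < suc K ] (t i * t i)   ∎
    where
    x : ℕ
    x = t zero
    ∑t≡ : sum t ≡ suc K * x
    ∑t≡ = trans (sum-cong-≗ (λ i → c i zero)) (∑-const (suc K) x)
    ∑t²≡ : ∑[ i < suc K ] (t i * t i) ≡ suc K * (x * x)
    ∑t²≡ = trans (sum-cong-≗ (λ i → cong₂ _*_ (c i zero) (c i zero))) (∑-const (suc K) (x * x))

module RationalBound where

  import Data.Nat as ℕ
  import Data.Nat.Properties as ℕ
  open import Data.Integer as ℤ using (+_; 1ℤ)
  import Data.Integer.Properties as ℤ
  open import Data.Integer.Tactic.RingSolver using (solve-∀)
  open import Data.Rational using (_/_; _+_; _*_; _-_; 1ℚ; ½; toℚᵘ)
  open import Data.Rational.Properties
  open import Data.Rational.Unnormalised as ℚᵘ using (ℚᵘ; mkℚᵘ; *≡*; *≤*)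
  import Data.Rational.Unnormalised.Properties as ℚᵘ
  open import Data.Rational.Solver using (module +-*-Solver)
  open import Algebra.Properties.Group +-0-group using (∙-cancelˡ)
  open import Algebra.Properties.Semiring.Sum ℕ.+-*-semiring using (sum; sum-syntax)
  open CauchySchwarz using (cauchy-schwarz; cauchy-schwarz-equality⇒Constant; Constant⇒cauchy-schwarz-equality)

  ℕ→ℚᵘ : ℕ → ℚᵘ
  ℕ→ℚᵘ x = mkℚᵘ (+ x) 0

  private
    toℚᵘ-ℕ→ℚ : ∀ x → toℚᵘ (ℕ→ℚ x) ℚᵘ.≃ ℕ→ℚᵘ x
    toℚᵘ-ℕ→ℚ x = toℚᵘ-fromℚᵘ (ℕ→ℚᵘ x)

    ℕ→ℚᵘ-+ : ∀ x y → ℕ→ℚᵘ (x ℕ.+ y) ℚᵘ.≃ ℕ→ℚᵘ x ℚᵘ.+ ℕ→ℚᵘ y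
    ℕ→ℚᵘ-+ x y = *≡* (trans (cong (ℤ._* 1ℤ) (ℤ.pos-+ x y)) (normalise (+ x) (+ y)))
      where
      normalise : ∀ a b → (a ℤ.+ b) ℤ.* 1ℤ ≡ (a ℤ.* 1ℤ ℤ.+ b ℤ.* 1ℤ) ℤ.* 1ℤ
      normalise = solve-∀

    ℕ→ℚᵘ-* : ∀ x y → ℕ→ℚᵘ (x ℕ.* y) ℚᵘ.≃ ℕ→ℚᵘ x ℚᵘ.* ℕ→ℚᵘ y
    ℕ→ℚᵘ-* x y = *≡* (cong (ℤ._* 1ℤ) (ℤ.pos-* x y))

  ℕ→ℚ-+ : ∀ x y → ℕ→ℚ (x ℕ.+ y) ≡ ℕ→ℚ x + ℕ→ℚ y
  ℕ→ℚ-+ x y = toℚᵘ-injective (begin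
    toℚᵘ (ℕ→ℚ (x ℕ.+ y))               ≈⟨ toℚᵘ-ℕ→ℚ (x ℕ.+ y) ⟩
    ℕ→ℚᵘ (x ℕ.+ y)                       ≈⟨ ℕ→ℚᵘ-+ x y ⟩
    ℕ→ℚᵘ x ℚᵘ.+ ℕ→ℚᵘ y                   ≈⟨ ℚᵘ.+-cong (toℚᵘ-ℕ→ℚ x) (toℚᵘ-ℕ→ℚ y) ⟨
    toℚᵘ (ℕ→ℚ x) ℚᵘ.+ toℚᵘ (ℕ→ℚ y)       ≈⟨ toℚᵘ-homo-+ (ℕ→ℚ x) (ℕ→ℚ y) ⟨
    toℚᵘ (ℕ→ℚ x + ℕ→ℚ y)                 ∎)
    where open ℚᵘ.≃-Reasoning

  ℕ→ℚ-* : ∀ x y → ℕ→ℚ (x ℕ.* y) ≡ ℕ→ℚ x * ℕ→ℚ y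
  ℕ→ℚ-* x y = toℚᵘ-injective (begin
    toℚᵘ (ℕ→ℚ (x ℕ.* y))               ≈⟨ toℚᵘ-ℕ→ℚ (x ℕ.* y) ⟩
    ℕ→ℚᵘ (x ℕ.* y)                       ≈⟨ ℕ→ℚᵘ-* x y ⟩
    ℕ→ℚᵘ x ℚᵘ.* ℕ→ℚᵘ y                   ≈⟨ ℚᵘ.*-cong (toℚᵘ-ℕ→ℚ x) (toℚᵘ-ℕ→ℚ y) ⟨
    toℚᵘ (ℕ→ℚ x) ℚᵘ.* toℚᵘ (ℕ→ℚ y)       ≈⟨ toℚᵘ-homo-* (ℕ→ℚ x) (ℕ→ℚ y) ⟨
    toℚᵘ (ℕ→ℚ x * ℕ→ℚ y)                 ∎)
    where open ℚᵘ.≃-Reasoning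

  ℕ→ℚ-injective : ∀ {x y} → ℕ→ℚ x ≡ ℕ→ℚ y → x ≡ y
  ℕ→ℚ-injective {x} {y} eq with fromℚᵘ-injective {ℕ→ℚᵘ x} {ℕ→ℚᵘ y} eq
  ... | *≡* e = ℤ.+-injective (trans (sym (ℤ.*-identityʳ (+ x))) (trans e (ℤ.*-identityʳ (+ y))))

  ℕ→ℚ-mono-≤ : ∀ {x y} → x ℕ.≤ y → ℕ→ℚ x ≤ℚ ℕ→ℚ y
  ℕ→ℚ-mono-≤ {x} {y} x≤y = toℚᵘ-cancel-≤
    (ℚᵘ.≤-respʳ-≃ (ℚᵘ.≃-sym (toℚᵘ-ℕ→ℚ y)) (ℚᵘ.≤-respˡ-≃ (ℚᵘ.≃-sym (toℚᵘ-ℕ→ℚ x))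
      (*≤* (ℤ.*-monoʳ-≤-nonNeg 1ℤ (ℤ.+≤+ x≤y)))))

  ℕ→ℚ-*-inverse : ∀ d → ℕ→ℚ (suc d) * (1ℤ / suc d) ≡ 1ℚ
  ℕ→ℚ-*-inverse d = toℚᵘ-injective (begin
    toℚᵘ (ℕ→ℚ (suc d) * (1ℤ / suc d))                ≈⟨ toℚᵘ-homo-* (ℕ→ℚ (suc d)) (1ℤ / suc d) ⟩
    toℚᵘ (ℕ→ℚ (suc d)) ℚᵘ.* toℚᵘ (1ℤ / suc d)        ≈⟨ ℚᵘ.*-cong (toℚᵘ-ℕ→ℚ (suc d)) (toℚᵘ-fromℚᵘ (mkℚᵘ 1ℤ d)) ⟩
    ℕ→ℚᵘ (suc d) ℚᵘ.* mkℚᵘ 1ℤ d                      ≈⟨ *≡* (cong (λ n → + suc n) d*1*1≡d+0+0) ⟩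
    ℚᵘ.1ℚᵘ                                           ∎)
    where
    open ℚᵘ.≃-Reasoning
    d*1*1≡d+0+0 : d ℕ.* 1 ℕ.* 1 ≡ d ℕ.+ 0 ℕ.+ 0
    d*1*1≡d+0+0 = trans (ℕ.*-identityʳ (d ℕ.* 1))
      (trans (ℕ.*-identityʳ d) (sym (trans (ℕ.+-identityʳ (d ℕ.+ 0)) (ℕ.+-identityʳ d))))

  ℕ→ℚ-*-/ℕ : ∀ d y → ℕ→ℚ (suc d ℕ.* y) /ℕ suc d ≡ ℕ→ℚ y
  ℕ→ℚ-*-/ℕ d y = begin
    ℕ→ℚ (suc d ℕ.* y) * v        ≡⟨ cong (_* v) (ℕ→ℚ-* (suc d) y) ⟩
    ℕ→ℚ (suc d) * ℕ→ℚ y * v      ≡⟨ solve 3 (λ n y v → n :* y :* v := y :* (n :* v)) refl (ℕ→ℚ (suc d)) (ℕ→ℚ y) v ⟩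
    ℕ→ℚ y * (ℕ→ℚ (suc d) * v)    ≡⟨ cong (ℕ→ℚ y *_) (ℕ→ℚ-*-inverse d) ⟩
    ℕ→ℚ y * 1ℚ                   ≡⟨ *-identityʳ (ℕ→ℚ y) ⟩
    ℕ→ℚ y                        ∎
    where
    open ≡-Reasoning
    open +-*-Solver
    v : ℚ
    v = 1ℤ / suc d

  ℕ→ℚ-/ℕ-≤ : ∀ d {x y} → x ℕ.≤ suc d ℕ.* y → ℕ→ℚ x /ℕ suc d ≤ℚ ℕ→ℚ y
  ℕ→ℚ-/ℕ-≤ d {x} {y} x≤dy = subst (ℕ→ℚ x /ℕ suc d ≤ℚ_) (ℕ→ℚ-*-/ℕ d y)
    (*-monoʳ-≤-nonNeg (1ℤ / suc d) {{normalize-nonNeg 1 (suc d)}} (ℕ→ℚ-mono-≤ x≤dy))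

  ℕ→ℚ-/ℕ-≡ : ∀ d x y → (ℕ→ℚ x /ℕ suc d ≡ ℕ→ℚ y) ⇔ (x ≡ suc d ℕ.* y)
  ℕ→ℚ-/ℕ-≡ d x y = mk⇔
    (λ eq → ℕ→ℚ-injective (begin
      ℕ→ℚ x                                ≡⟨ ℕ→ℚ-*-/ℕ d x ⟨
      ℕ→ℚ (suc d ℕ.* x) /ℕ suc d           ≡⟨ cong (_/ℕ suc d) (ℕ→ℚ-* (suc d) x) ⟩
      (ℕ→ℚ (suc d) * ℕ→ℚ x) * v            ≡⟨ *-assoc (ℕ→ℚ (suc d)) (ℕ→ℚ x) v ⟩
      ℕ→ℚ (suc d) * (ℕ→ℚ x /ℕ suc d)       ≡⟨ cong (ℕ→ℚ (suc d) *_) eq ⟩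
      ℕ→ℚ (suc d) * ℕ→ℚ y                  ≡⟨ ℕ→ℚ-* (suc d) y ⟨
      ℕ→ℚ (suc d ℕ.* y)                    ∎))
    (λ { refl → ℕ→ℚ-*-/ℕ d y })
    where
    open ≡-Reasoning
    v : ℚ
    v = 1ℤ / suc d

  private
    two : ℚ
    two = ℕ→ℚ 2

  -- The left-hand side is `bound n m a b c` for A, B, C the images of a, b, c,
  -- K = n − 3, u = 1/(n − 1), w = 1/(n − 3) and R = 2m − a − b − c. The
  -- difference of the two sides lies in the ideal generated by (2 + K) u − 1
  -- and K w − 1; `certificate` exhibits the cofactors.
  bound-shape≡sum-of-squares : ∀ A B C R K u w → (two + K) * u ≡ 1ℚ → K * w ≡ 1ℚ →
    sq A + sq (B + C + R) * u + sq (B - C) * ½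
      + ((two * (two + K)) * w) * sq ((B + C + R) * u - (B + C) * ½)
    ≡ sq A + sq B + sq C + sq R * w
  bound-shape≡sum-of-squares A B C R K u w N*u≡1 K*w≡1 = begin
    sq A + sq S * u + sq (B - C) * ½ + ((two * (two + K)) * w) * sq (S * u - s * ½)
      ≡⟨ certificate A B C R K u w ⟩
    Z + ((two + K) * u - 1ℚ) * X + (K * w - 1ℚ) * Y
      ≡⟨ cong₂ (λ e₁ e₂ → Z + (e₁ - 1ℚ) * X + (e₂ - 1ℚ) * Y) N*u≡1 K*w≡1 ⟩
    Z + (1ℚ - 1ℚ) * X + (1ℚ - 1ℚ) * Y
      ≡⟨ solve 3 (λ Z X Y → Z :+ (con 1ℚ :- con 1ℚ) :* X :+ (con 1ℚ :- con 1ℚ) :* Y := Z) refl Z X Y ⟩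
    Z ∎
    where
    open ≡-Reasoning
    open +-*-Solver
    s S Z X Y : ℚ
    s = B + C
    S = B + C + R
    Z = sq A + sq B + sq C + sq R * w
    X = w * sq S + two * w * S * (S * u - s)
    Y = sq s * ½ - sq S * u
    certificate : ∀ A B C R K u w →
      sq A + sq (B + C + R) * u + sq (B - C) * ½
        + ((two * (two + K)) * w) * sq ((B + C + R) * u - (B + C) * ½)
      ≡ sq A + sq B + sq C + sq R * w
        + ((two + K) * u - 1ℚ) * (w * sq (B + C + R) + two * w * (B + C + R) * ((B + C + R) * u - (B + C)))
        + (K * w - 1ℚ) * (sq (B + C) * ½ - sq (B + C + R) * u)
    certificate = solve 7 (λ A B C R K u w →
      A :* A :+ ((B :+ C :+ R) :* (B :+ C :+ R)) :* u :+ ((B :- C) :* (B :- C)) :* con ½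
        :+ ((con two :* (con two :+ K)) :* w)
           :* (((B :+ C :+ R) :* u :- (B :+ C) :* con ½) :* ((B :+ C :+ R) :* u :- (B :+ C) :* con ½))
      := A :* A :+ B :* B :+ C :* C :+ (R :* R) :* w
        :+ ((con two :+ K) :* u :- con 1ℚ)
           :* (w :* ((B :+ C :+ R) :* (B :+ C :+ R)) :+ con two :* w :* (B :+ C :+ R) :* ((B :+ C :+ R) :* u :- (B :+ C)))
        :+ (K :* w :- con 1ℚ) :* (((B :+ C) :* (B :+ C)) :* con ½ :- ((B :+ C :+ R) :* (B :+ C :+ R)) :* u)) refl

  ℕ→ℚ-sum-of-three-squares : ∀ F a b →
    ℕ→ℚ (F ℕ.* F ℕ.+ a ℕ.* a ℕ.+ b ℕ.* b) ≡ sq (ℕ→ℚ F) + sq (ℕ→ℚ a) + sq (ℕ→ℚ b)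
  ℕ→ℚ-sum-of-three-squares F a b = begin
    ℕ→ℚ (F ℕ.* F ℕ.+ a ℕ.* a ℕ.+ b ℕ.* b)                        ≡⟨ ℕ→ℚ-+ (F ℕ.* F ℕ.+ a ℕ.* a) (b ℕ.* b) ⟩
    ℕ→ℚ (F ℕ.* F ℕ.+ a ℕ.* a) + ℕ→ℚ (b ℕ.* b)                    ≡⟨ cong (_+ ℕ→ℚ (b ℕ.* b)) (ℕ→ℚ-+ (F ℕ.* F) (a ℕ.* a)) ⟩
    ℕ→ℚ (F ℕ.* F) + ℕ→ℚ (a ℕ.* a) + ℕ→ℚ (b ℕ.* b)                ≡⟨ cong₂ _+_ (cong₂ _+_ (ℕ→ℚ-* F F) (ℕ→ℚ-* a a)) (ℕ→ℚ-* b b) ⟩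
    sq (ℕ→ℚ F) + sq (ℕ→ℚ a) + sq (ℕ→ℚ b)                          ∎
    where open ≡-Reasoning

  bound≡sum-of-squares : ∀ k m F a b R → 2 ℕ.* m ≡ F ℕ.+ a ℕ.+ b ℕ.+ R →
    bound (4 ℕ.+ k) m F a b ≡ ℕ→ℚ (F ℕ.* F ℕ.+ a ℕ.* a ℕ.+ b ℕ.* b) + ℕ→ℚ (R ℕ.* R) /ℕ suc k
  bound≡sum-of-squares k m F a b R 2m≡ = begin
    bound (4 ℕ.+ k) m F a b
      ≡⟨ cong₂ shape 2m-F≡ 2N≡ ⟩
    shape (B + C + ℕ→ℚ R) (two * (two + K))
      ≡⟨ bound-shape≡sum-of-squares A B C (ℕ→ℚ R) K u w N*u≡1 (ℕ→ℚ-*-inverse k) ⟩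
    sq A + sq B + sq C + sq (ℕ→ℚ R) * w
      ≡⟨ cong₂ _+_ (ℕ→ℚ-sum-of-three-squares F a b) (cong (_* w) (ℕ→ℚ-* R R)) ⟨
    ℕ→ℚ (F ℕ.* F ℕ.+ a ℕ.* a ℕ.+ b ℕ.* b) + ℕ→ℚ (R ℕ.* R) /ℕ suc k
      ∎
    where
    open ≡-Reasoning
    open +-*-Solver
    A B C K u w : ℚ
    A = ℕ→ℚ F
    B = ℕ→ℚ a
    C = ℕ→ℚ b
    K = ℕ→ℚ (suc k)
    u = 1ℤ / suc (suc (suc k))
    w = 1ℤ / suc k
    shape : ℚ → ℚ → ℚ
    shape S N = sq A + sq S * u + sq (B - C) * ½ + (N * w) * sq (S * u - (B + C) * ½)
    2m-F≡ : ℕ→ℚ (2 ℕ.* m) - A ≡ B + C + ℕ→ℚ R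
    2m-F≡ = begin
      ℕ→ℚ (2 ℕ.* m) - A                      ≡⟨ cong (λ x → ℕ→ℚ x - A) 2m≡ ⟩
      ℕ→ℚ (F ℕ.+ a ℕ.+ b ℕ.+ R) - A          ≡⟨ cong (_- A) (trans (ℕ→ℚ-+ (F ℕ.+ a ℕ.+ b) R)
                                                  (cong (_+ ℕ→ℚ R) (trans (ℕ→ℚ-+ (F ℕ.+ a) b) (cong (_+ C) (ℕ→ℚ-+ F a))))) ⟩
      A + B + C + ℕ→ℚ R - A                  ≡⟨ solve 4 (λ A B C R → A :+ B :+ C :+ R :- A := B :+ C :+ R) refl A B C (ℕ→ℚ R) ⟩
      B + C + ℕ→ℚ R                          ∎
    2N≡ : ℕ→ℚ (2 ℕ.* suc (suc (suc k))) ≡ two * (two + K)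
    2N≡ = trans (ℕ→ℚ-* 2 (suc (suc (suc k)))) (cong (two *_) (ℕ→ℚ-+ 2 (suc k)))
    N*u≡1 : (two + K) * u ≡ 1ℚ
    N*u≡1 = trans (cong (_* u) (sym (ℕ→ℚ-+ 2 (suc k)))) (ℕ→ℚ-*-inverse (suc (suc k)))

  bound≤-and-equality : ∀ k m F a b (t : Vector ℕ (suc k)) M →
    2 ℕ.* m ≡ F ℕ.+ a ℕ.+ b ℕ.+ sum t →
    M ≡ F ℕ.* F ℕ.+ a ℕ.* a ℕ.+ b ℕ.* b ℕ.+ ∑[ i < suc k ] (t i ℕ.* t i) →
    bound (4 ℕ.+ k) m F a b ≤ℚ ℕ→ℚ M × ((ℕ→ℚ M ≡ bound (4 ℕ.+ k) m F a b) ⇔ Constant t)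
  bound≤-and-equality k m F a b t M 2m≡ M≡ =
    subst₂ _≤ℚ_ (sym bound≡) (sym ℕ→ℚM≡) (+-monoʳ-≤ P (ℕ→ℚ-/ℕ-≤ k (cauchy-schwarz t))) ,
    mk⇔
      (λ eq → cauchy-schwarz-equality⇒Constant t (Equivalence.to (ℕ→ℚ-/ℕ-≡ k R² Q)
        (sym (∙-cancelˡ P _ _ (trans (sym ℕ→ℚM≡) (trans eq bound≡))))))
      (λ c → trans ℕ→ℚM≡ (trans (cong (_+_ P)
        (sym (Equivalence.from (ℕ→ℚ-/ℕ-≡ k R² Q) (Constant⇒cauchy-schwarz-equality t c)))) (sym bound≡)))
    where
    P : ℚ
    P = ℕ→ℚ (F ℕ.* F ℕ.+ a ℕ.* a ℕ.+ b ℕ.* b)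
    R² Q : ℕ
    R² = sum t ℕ.* sum t
    Q = ∑[ i < suc k ] (t i ℕ.* t i)
    bound≡ : bound (4 ℕ.+ k) m F a b ≡ P + ℕ→ℚ R² /ℕ suc k
    bound≡ = bound≡sum-of-squares k m F a b (sum t) 2m≡
    ℕ→ℚM≡ : ℕ→ℚ M ≡ P + ℕ→ℚ Q
    ℕ→ℚM≡ = trans (cong ℕ→ℚ M≡) (ℕ→ℚ-+ (F ℕ.* F ℕ.+ a ℕ.* a ℕ.+ b ℕ.* b) Q)

module Degrees where

  open import Data.Bool using (Bool; true; false; if_then_else_; _∧_)
  open import Data.Nat using (_+_; _*_; _^_; _<_; _<ᵇ_; _<?_; z≤n; s≤s; s≤s⁻¹)
  open import Data.Nat.Properties
  open import Data.Nat.Tactic.RingSolver using (solve-∀)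
  import Data.Nat.ListAction as List
  open import Data.Fin using (zero; suc; fromℕ<)
  open import Data.Fin.Properties using (toℕ-injective; toℕ<n; toℕ-fromℕ<; fromℕ<-toℕ)
  open import Data.List using (map; allFin; tabulate)
  open import Data.List.Properties using (map-tabulate)
  open import Algebra.Properties.Semiring.Sum +-*-semiring
    using (sum; sum-syntax; sum-cong-≗; ∑-distrib-+; ∑-comm)
  open import Relation.Nullary using (yes; no; contradiction)
  open import Relation.Binary.PropositionalEquality using (_≢_)
  open ≡-Reasoning

  sum-tabulate : ∀ {n} (f : Fin n → ℕ) → List.sum (tabulate f) ≡ sum f
  sum-tabulate {zero}  f = refl
  sum-tabulate {suc n} f = cong (f zero +_) (sum-tabulate (f ∘ suc))

  sum-map-allFin : ∀ {n} (f : Fin n → ℕ) → List.sum (map f (allFin n)) ≡ sum f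
  sum-map-allFin f = trans (cong List.sum (map-tabulate (λ i → i) f)) (sum-tabulate f)

  indicator : Bool → ℕ
  indicator b = if b then 1 else 0

  indicator-<ᵇ-+-flip : ∀ {m n} → m ≢ n → indicator (m <ᵇ n) + indicator (n <ᵇ m) ≡ 1
  indicator-<ᵇ-+-flip {zero}  {zero}  m≢n = contradiction refl m≢n
  indicator-<ᵇ-+-flip {zero}  {suc n} _   = refl
  indicator-<ᵇ-+-flip {suc m} {zero}  _   = refl
  indicator-<ᵇ-+-flip {suc m} {suc n} m≢n = indicator-<ᵇ-+-flip (m≢n ∘ cong suc)

  arc : ∀ {n} → SimpleGraph n → Fin n → Fin n → ℕ
  arc G u v = indicator (adj G u v ∧ (toℕ u <ᵇ toℕ v))

  indicator-adj≡arc+arc : ∀ {n} (G : SimpleGraph n) u v → indicator (adj G u v) ≡ arc G u v + arc G v u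
  indicator-adj≡arc+arc G u v with adj G u v in uv | adj G v u | SimpleGraph.sym G v u
  ... | false | .false | refl = refl
  ... | true  | .true  | refl = sym (indicator-<ᵇ-+-flip u≢v)
    where
    u≢v : toℕ u ≢ toℕ v
    u≢v eq with toℕ-injective eq
    ... | refl = contradiction (trans (sym uv) (irrefl G u)) λ ()

  module _ {n} (G : SimpleGraph n) where

    private
      E : ℕ
      E = ∑[ u < n ] ∑[ v < n ] arc G u v

    deg≡∑arc+arc : ∀ u → deg G u ≡ ∑[ v < n ] (arc G u v + arc G v u)
    deg≡∑arc+arc u = trans (sum-map-allFin (indicator ∘ adj G u)) (sum-cong-≗ (indicator-adj≡arc+arc G u))

    edges≡∑∑arc : edges G ≡ ∑[ u < n ] ∑[ v < n ] arc G u v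
    edges≡∑∑arc = trans (sum-map-allFin (λ u → List.sum (map (arc G u) (allFin n))))
                        (sum-cong-≗ (λ u → sum-map-allFin (arc G u)))

    handshake : ∑[ u < n ] deg G u ≡ 2 * edges G
    handshake = begin
      ∑[ u < n ] deg G u                                          ≡⟨ sum-cong-≗ deg≡∑arc+arc ⟩
      ∑[ u < n ] ∑[ v < n ] (arc G u v + arc G v u)              ≡⟨ sum-cong-≗ (λ u → ∑-distrib-+ (arc G u) (λ v → arc G v u)) ⟩
      ∑[ u < n ] (∑[ v < n ] arc G u v + ∑[ v < n ] arc G v u)   ≡⟨ ∑-distrib-+ (λ u → ∑[ v < n ] arc G u v) (λ u → ∑[ v < n ] arc G v u) ⟩
      E + ∑[ u < n ] ∑[ v < n ] arc G v u                         ≡⟨ cong (E +_) (∑-comm (λ u v → arc G v u)) ⟩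
      E + E                                                       ≡⟨ cong (E +_) (+-identityʳ E) ⟨
      2 * E                                                       ≡⟨ cong (2 *_) edges≡∑∑arc ⟨
      2 * edges G                                                 ∎

    deg≡dseq : ∀ u → deg G u ≡ dseq G (suc (toℕ u))
    deg≡dseq u with toℕ u <? n
    ... | yes p = cong (deg G) (sym (fromℕ<-toℕ u p))
    ... | no ¬p = contradiction (toℕ<n u) ¬p

    degree-sum : ∑[ i < n ] dseq G (suc (toℕ i)) ≡ 2 * edges G
    degree-sum = trans (sum-cong-≗ (sym ∘ deg≡dseq)) handshake

    M1≡∑dseq² : M1 G ≡ ∑[ i < n ] (dseq G (suc (toℕ i)) * dseq G (suc (toℕ i)))
    M1≡∑dseq² = trans (sum-map-allFin (λ u → deg G u ^ 2)) (sum-cong-≗ λ u →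
      trans (cong (_^ 2) (deg≡dseq u)) (cong (dseq G (suc (toℕ u)) *_) (*-identityʳ _)))

  ∑-toℕ-last : ∀ K (g : ℕ → ℕ) → ∑[ i < suc K ] g (toℕ i) ≡ ∑[ i < K ] g (toℕ i) + g K
  ∑-toℕ-last zero    g = +-identityʳ (g 0)
  ∑-toℕ-last (suc K) g = trans (cong (g 0 +_) (∑-toℕ-last K (g ∘ suc))) (sym (+-assoc (g 0) _ (g (suc K))))

  split-first-second-last : ∀ k (g : ℕ → ℕ) →
    ∑[ i < 4 + k ] g (toℕ i) ≡ g 0 + g 1 + g (3 + k) + ∑[ i < suc k ] g (2 + toℕ i)
  split-first-second-last k g =
    trans (cong (λ x → g 0 + (g 1 + x)) (∑-toℕ-last (suc k) (λ j → g (2 + j))))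
          (rearrange (g 0) (g 1) (∑[ i < suc k ] g (2 + toℕ i)) (g (3 + k)))
    where
    rearrange : ∀ a b s c → a + (b + (s + c)) ≡ a + b + c + s
    rearrange = solve-∀

  split-last-first-penultimate : ∀ k (g : ℕ → ℕ) →
    ∑[ i < 4 + k ] g (toℕ i) ≡ g (3 + k) + g 0 + g (2 + k) + ∑[ i < suc k ] g (1 + toℕ i)
  split-last-first-penultimate k g =
    trans (cong (g 0 +_) (trans (∑-toℕ-last (suc (suc k)) (λ j → g (1 + j)))
                                (cong (_+ g (3 + k)) (∑-toℕ-last (suc k) (λ j → g (1 + j))))))
          (rearrange (g 0) (∑[ i < suc k ] g (1 + toℕ i)) (g (2 + k)) (g (3 + k)))
    where
    rearrange : ∀ a s b c → a + (s + b + c) ≡ c + a + b + s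
    rearrange = solve-∀

  module _ {n} (G : SimpleGraph n) where

    Γ-mono : ∀ {i j i′ j′} → i ≤ i′ → i′ ≤ j′ → j′ ≤ j → Γ i j G → Γ i′ j′ G
    Γ-mono i≤i′ i′≤j′ j′≤j γ k i′≤k k≤j′ =
      trans (γ k (≤-trans i≤i′ i′≤k) (≤-trans k≤j′ j′≤j)) (sym (γ _ i≤i′ (≤-trans i′≤j′ j′≤j)))

    Regular⇒Γ : Regular G → Γ 1 n G
    Regular⇒Γ reg zero    ()
    Regular⇒Γ reg (suc j) _ j<n with j <? n | 0 <? n
    ... | yes p | yes q = reg (fromℕ< p) (fromℕ< q)
    ... | no ¬p | _     = contradiction j<n ¬p
    ... | yes _ | no ¬q = contradiction (≤-trans (s≤s z≤n) j<n) ¬q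

    Constant⇔Γ : ∀ c k → Constant (λ (i : Fin (suc k)) → dseq G (c + toℕ i)) ⇔ Γ c (c + k) G
    Constant⇔Γ c k = mk⇔
      (λ const j c≤j j≤c+k → trans (cong (dseq G) (sym (index j c≤j j≤c+k)))
        (trans (const _ zero) (cong (dseq G) (+-identityʳ c))))
      (λ γ i i′ → trans (at γ i) (sym (at γ i′)))
      where
      j∸c<1+k : ∀ {j} → j ≤ c + k → j ∸ c < suc k
      j∸c<1+k j≤c+k = s≤s (subst (_ ≤_) (m+n∸m≡n c k) (∸-monoˡ-≤ c j≤c+k))
      index : ∀ j (c≤j : c ≤ j) (j≤c+k : j ≤ c + k) → c + toℕ (fromℕ< (j∸c<1+k j≤c+k)) ≡ j
      index j c≤j j≤c+k = trans (cong (c +_) (toℕ-fromℕ< (j∸c<1+k j≤c+k))) (m+[n∸m]≡n c≤j)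
      at : Γ c (c + k) G → ∀ (i : Fin (suc k)) → dseq G (c + toℕ i) ≡ dseq G c
      at γ i = γ (c + toℕ i) (m≤m+n c (toℕ i)) (+-monoʳ-≤ c (s≤s⁻¹ (toℕ<n i)))

open import Data.Nat using (_+_; _*_; z≤n; s≤s)
open import Data.Nat.Properties using (≤-refl; ≤-trans; n≤1+n; m≤m+n)
open import Data.Product using (map₂)
open import Function.Properties.Equivalence using () renaming (trans to ⇔-trans; sym to ⇔-sym)
open RationalBound using (bound≤-and-equality)
open Degrees

module _ {k} (G : SimpleGraph (4 + k)) where

  private
    d : ℕ → ℕ
    d i = dseq G (suc i)

  zagreb-bound-Δ :
    bound (4 + k) (edges G) (dseq G 1) (dseq G 2) (dseq G (4 + k)) ≤ℚ ℕ→ℚ (M1 G)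
    × ((ℕ→ℚ (M1 G) ≡ bound (4 + k) (edges G) (dseq G 1) (dseq G 2) (dseq G (4 + k))) ⇔ Γ 3 (3 + k) G)
  zagreb-bound-Δ = map₂ (λ eq → ⇔-trans eq (Constant⇔Γ G 3 k))
    (bound≤-and-equality k (edges G) (d 0) (d 1) (d (3 + k)) (λ i → d (2 + toℕ i)) (M1 G)
      (trans (sym (degree-sum G)) (split-first-second-last k d))
      (trans (M1≡∑dseq² G) (split-first-second-last k (λ j → d j * d j))))

  zagreb-bound-δ :
    bound (4 + k) (edges G) (dseq G (4 + k)) (dseq G 1) (dseq G (3 + k)) ≤ℚ ℕ→ℚ (M1 G)
    × ((ℕ→ℚ (M1 G) ≡ bound (4 + k) (edges G) (dseq G (4 + k)) (dseq G 1) (dseq G (3 + k))) ⇔ Γ 2 (2 + k) G)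
  zagreb-bound-δ = map₂ (λ eq → ⇔-trans eq (Constant⇔Γ G 2 k))
    (bound≤-and-equality k (edges G) (d (3 + k)) (d 0) (d (2 + k)) (λ i → d (1 + toℕ i)) (M1 G)
      (trans (sym (degree-sum G)) (split-last-first-penultimate k d))
      (trans (M1≡∑dseq² G) (split-last-first-penultimate k (λ j → d j * d j))))

  Δ-cases⇔Γ :
    (Regular G ⊎ Γ 3 (3 + k) G ⊎ Γ 3 (4 + k) G ⊎ Γ 2 (3 + k) G ⊎ Γ 2 (4 + k) G ⊎ Γ 1 (3 + k) G)
    ⇔ Γ 3 (3 + k) G
  Δ-cases⇔Γ = mk⇔ narrow (inj₂ ∘ inj₁)
    where
    narrow : _ → Γ 3 (3 + k) G
    narrow (inj₁ reg)                                 = Γ-mono G (s≤s z≤n) (m≤m+n 3 k) (n≤1+n _) (Regular⇒Γ G reg)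
    narrow (inj₂ (inj₁ γ))                            = γ
    narrow (inj₂ (inj₂ (inj₁ γ)))                     = Γ-mono G ≤-refl (m≤m+n 3 k) (n≤1+n _) γ
    narrow (inj₂ (inj₂ (inj₂ (inj₁ γ))))              = Γ-mono G (n≤1+n 2) (m≤m+n 3 k) ≤-refl γ
    narrow (inj₂ (inj₂ (inj₂ (inj₂ (inj₁ γ)))))       = Γ-mono G (n≤1+n 2) (m≤m+n 3 k) (n≤1+n _) γ
    narrow (inj₂ (inj₂ (inj₂ (inj₂ (inj₂ γ)))))       = Γ-mono G (s≤s z≤n) (m≤m+n 3 k) ≤-refl γ

  δ-cases⇔Γ :
    (Regular G ⊎ Γ 2 (2 + k) G ⊎ Γ 2 (3 + k) G ⊎ Γ 2 (4 + k) G ⊎ Γ 1 (2 + k) G ⊎ Γ 1 (3 + k) G)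
    ⇔ Γ 2 (2 + k) G
  δ-cases⇔Γ = mk⇔ narrow (inj₂ ∘ inj₁)
    where
    2+k≤4+k : 2 + k ≤ 4 + k
    2+k≤4+k = ≤-trans (n≤1+n _) (n≤1+n _)
    narrow : _ → Γ 2 (2 + k) G
    narrow (inj₁ reg)                                 = Γ-mono G (s≤s z≤n) (m≤m+n 2 k) 2+k≤4+k (Regular⇒Γ G reg)
    narrow (inj₂ (inj₁ γ))                            = γ
    narrow (inj₂ (inj₂ (inj₁ γ)))                     = Γ-mono G ≤-refl (m≤m+n 2 k) (n≤1+n _) γ
    narrow (inj₂ (inj₂ (inj₂ (inj₁ γ))))              = Γ-mono G ≤-refl (m≤m+n 2 k) 2+k≤4+k γ
    narrow (inj₂ (inj₂ (inj₂ (inj₂ (inj₁ γ)))))       = Γ-mono G (s≤s z≤n) (m≤m+n 2 k) ≤-refl γ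
    narrow (inj₂ (inj₂ (inj₂ (inj₂ (inj₂ γ)))))       = Γ-mono G (s≤s z≤n) (m≤m+n 2 k) (n≤1+n _) γ

corollary5 : (n : ℕ) → 4 ≤ n → (G : SimpleGraph n) → DegreesNonIncreasing G →
    (bound n (edges G) (dseq G 1) (dseq G 2) (dseq G n) ≤ℚ ℕ→ℚ (M1 G))
    × (bound n (edges G) (dseq G n) (dseq G 1) (dseq G (n ∸ 1)) ≤ℚ ℕ→ℚ (M1 G))
    × ((ℕ→ℚ (M1 G) ≡ bound n (edges G) (dseq G 1) (dseq G 2) (dseq G n))
        ⇔ (Regular G ⊎ Γ 3 (n ∸ 1) G ⊎ Γ 3 n G ⊎ Γ 2 (n ∸ 1) G ⊎ Γ 2 n G ⊎ Γ 1 (n ∸ 1) G))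
    × ((ℕ→ℚ (M1 G) ≡ bound n (edges G) (dseq G n) (dseq G 1) (dseq G (n ∸ 1)))
        ⇔ (Regular G ⊎ Γ 2 (n ∸ 2) G ⊎ Γ 2 (n ∸ 1) G ⊎ Γ 2 n G ⊎ Γ 1 (n ∸ 2) G ⊎ Γ 1 (n ∸ 1) G))
corollary5 (suc (suc (suc (suc k)))) (s≤s (s≤s (s≤s (s≤s z≤n)))) G _ =
  proj₁ (zagreb-bound-Δ G) ,
  proj₁ (zagreb-bound-δ G) ,
  ⇔-trans (proj₂ (zagreb-bound-Δ G)) (⇔-sym (Δ-cases⇔Γ G)) ,
  ⇔-trans (proj₂ (zagreb-bound-δ G)) (⇔-sym (δ-cases⇔Γ G))
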